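{- Let $b\in\mathcal{F}$ and let $\mathcal{O}$ be an orbit of binary trees with at least one vertex, with left and right orbits $\mathcal{O}_L,\mathcal{O}_R$. Then for every $m\ge0$, \[\varepsilon_m^{\mathcal{O}}\equiv\sum_{i+j+k=m}\binom{m}{i,j,k}\varepsilon_k\left(\varepsilon_i^{\mathcal{O}_L}\varepsilon_j^{\mathcal{O}_R}+\varepsilon_{i+1}^{\mathcal{O}_L}\varepsilon_j^{\mathcal{O}_R}+\varepsilon_i^{\mathcal{O}_L}\varepsilon_{j+1}^{\mathcal{O}_R}\right)\pmod 2,\] the sum being over nonnegative integers $i,j,k$.
   Context: $(\Delta f)(x)=f(x+1)-f(x)$. $\mathcal{F}$ is the set of functions $f:\mathbb{Z}_{\ge0}\to\mathbb{Z}$ with $2^n\mid(\Delta^n f)(x)$ for all $n\ge0$, $x\ge0$. For $f\in\mathcal{F}$ and $n\ge0$, $\Delta^nf$ is constant modulo $2^{n+1}$ and congruent to $0$ or $2^n$; set $\varepsilon_n^f=0$ in the first case and $1$ in the second. Write $\varepsilon_k=\varepsilon_k^b$. A binary tree is a rooted tree in which each vertex has possibly a left child and/or a right child. The group $G_n$ acts on binary trees with $n$ vertices, generated by swapping the left and right subtrees at a vertex; orbits are orbits of this action. For a binary tree $T$ and $x\in\mathbb{Z}_{\ge0}$ let $w_b(T;x)=\prod_{v\in T}b(x+l_v)$, $l_v$ being the number of left edges on the path from the root to $v$; for an orbit $\mathcal{O}$ let $r_b(\mathcal{O};x)=\frac1{|\mathcal{O}|}\sum_{T\in\mathcal{O}}w_b(T;x)$.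 Each $r_b(\mathcal{O};\cdot)$ belongs to $\mathcal{F}$, and $\varepsilon_m^{\mathcal{O}}:=\varepsilon_m^{r_b(\mathcal{O};\cdot)}$. For the orbit of the empty tree, $r_b=1$, so $\varepsilon_0=1$ and $\varepsilon_m=0$ for $m\ge1$. For a nonempty orbit $\mathcal{O}$, $\mathcal{O}_L$ and $\mathcal{O}_R$ are the orbits of the left and right subtrees of the root of a tree in $\mathcal{O}$ (possibly empty). $\binom{m}{i,j,k}$ is the multinomial coefficient. -}

module Defs where

open import Data.Nat as ℕ using (ℕ; zero; suc)
open import Data.Nat.DivMod as NDM using ()
open import Data.Nat.Combinatorics using ()
open import Data.Nat.Base using (_!)
open import Data.Integer as ℤ using (ℤ; +_; _-_)
open import Data.Integer.DivMod using (_/ℕ_; _%ℕ_)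
open import Data.Integer.Divisibility using (_∣_)
open import Data.List using (List; []; _∷_; _++_; map; foldr; length; deduplicate; cartesianProductWith)
open import Relation.Binary.PropositionalEquality using (_≡_; refl; cong; cong₂)
open import Relation.Nullary using (Dec; yes; no)
open import Data.Product using (_×_; _,_)

-- Division of a natural / integer by a natural, guarded against a zero divisor
-- (only ever applied to nonzero divisors below).
_÷ℕ_ : ℕ → ℕ → ℕ
a ÷ℕ zero = 0
a ÷ℕ suc n = NDM._/_ a (suc n)

_÷ℤ_ : ℤ → ℕ → ℤ
a ÷ℤ zero = + 0
a ÷ℤ suc n = a /ℕ suc n

Δ : (ℕ → ℤ) → (ℕ → ℤ)
Δ f x = f (suc x) - f x

Δ^ : ℕ → (ℕ → ℤ) → (ℕ → ℤ)
Δ^ zero f = f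
Δ^ (suc n) f = Δ (Δ^ n f)

InF : (ℕ → ℤ) → Set
InF f = ∀ (n x : ℕ) → (+ (2 ℕ.^ n)) ∣ Δ^ n f x

-- ε_n^f : Δ^n f is constant mod 2^(n+1) and ≡ 0 or 2^n; ε = ((Δ^n f)(0) / 2^n) mod 2.
ε : ℕ → (ℕ → ℤ) → ℕ
ε n f = (Δ^ n f 0 ÷ℤ (2 ℕ.^ n)) %ℕ 2

-- Binary trees: empty tree, or a root with (possibly empty) left and right subtrees.
data Tree : Set where
  leaf : Tree
  node : Tree → Tree → Tree

node-injˡ : ∀ {a b c d} → node a b ≡ node c d → a ≡ c
node-injˡ refl = refl

node-injʳ : ∀ {a b c d} → node a b ≡ node c d → b ≡ d
node-injʳ refl = refl

_≟T_ : (s t : Tree) → Dec (s ≡ t)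
leaf ≟T leaf = yes refl
leaf ≟T node _ _ = no (λ ())
node _ _ ≟T leaf = no (λ ())
node a b ≟T node c d with a ≟T c | b ≟T d
... | yes refl | yes refl = yes refl
... | no p | _ = no (λ e → p (node-injˡ e))
... | yes _ | no q = no (λ e → q (node-injʳ e))

-- All images g·T of T under the group generated by swapping the left and right
-- subtrees at vertices (each vertex independently swapped or not), as a list
-- possibly with repetitions.
flips : Tree → List Tree
flips leaf = leaf ∷ []
flips (node l r) =
  cartesianProductWith node (flips l) (flips r) ++
  cartesianProductWith (λ a b → node b a) (flips l) (flips r)

orbit : Tree → List Tree
orbit t = deduplicate _≟T_ (flips t)

-- w_b(T;x) = ∏_{v ∈ T} b(x + l_v), l_v = number of left edges from the root to v.
w : (ℕ → ℤ) → Tree → ℕ → ℤ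
w b leaf x = + 1
w b (node l r) x = b x ℤ.* (w b l (suc x) ℤ.* w b r x)

sumℤ : List ℤ → ℤ
sumℤ = foldr ℤ._+_ (+ 0)

r : (ℕ → ℤ) → Tree → ℕ → ℤ
r b t x = sumℤ (map (λ s → w b s x) (orbit t)) ÷ℤ length (orbit t)

εO : (ℕ → ℤ) → ℕ → Tree → ℕ
εO b m t = ε m (r b t)

multinomial : ℕ → ℕ → ℕ → ℕ → ℕ
multinomial m i j k = (m !) ÷ℕ ((i !) ℕ.* (j !) ℕ.* (k !))

Σ< : ℕ → (ℕ → ℕ) → ℕ
Σ< zero f = 0
Σ< (suc n) f = Σ< n f ℕ.+ f n

Σtriple : ℕ → (ℕ → ℕ → ℕ → ℕ) → ℕ
Σtriple m f = Σ< (suc m) (λ i → Σ< (suc (m ℕ.∸ i)) (λ j → f i j (m ℕ.∸ i ℕ.∸ j)))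

module Submission where

-- For f ∈ 𝓕 let  digit n f x = Δⁿf(x)/2ⁿ ∈ ℤ,  so that ε_n^f is the parity of
-- digit n f 0.  Everything rests on the half difference Df = Δf/2: it satisfies
-- f(x+1) = f(x) + 2·Df(x), lies again in 𝓕, and digit n (Df) = digit (n+1) f.
-- Expanding Δ(fg) = 2(Df·g + f·Dg) + 4·Df·Dg shows that 𝓕 is closed under
-- products and gives the Leibniz rule modulo 2,
--   digit m (fg) ≡ Σ_{i+j=m} C(m,i)·digit i f·digit j g   (mod 2).
-- On the combinatorial side, the orbit of node tl tr is, up to permutation, the
-- product of the orbits of tl and tr, doubled by the root swap unless tl and tr
-- lie in one orbit; in both cases averaging yields, by induction on trees,
--   r_b(node tl tr) = b·(f·g + Df·g + f·Dg),   f = r_b(tl), g = r_b(tr),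
-- and r_b(𝓞) ∈ 𝓕.  The lemma follows by applying the Leibniz rule to this
-- product twice, reducing all digits modulo 2, and collapsing the two nested
-- binomial expansions into the trinomial sum of the statement.

open import Defs
open import Data.Integer using (ℤ)
open import Data.Nat using (ℕ; suc; _+_; _*_; _%_)
open import Relation.Binary.PropositionalEquality using (_≡_)

open import Data.Nat as N using (zero; _∸_; _≤_; _<_; s≤s; z≤n; _!)
import Data.Nat.Properties as NP
import Data.Nat.DivMod as ND
open import Data.Nat.Combinatorics using (_C_; nCk+nC[k+1]≡[n+1]C[k+1]; k>n⇒nCk≡0; k![n∸k]!∣n!)
open import Data.Nat.Combinatorics.Specification using (nCk≡n!/k![n-k]!)
import Data.Nat.Tactic.RingSolver as ℕSolver
open import Data.Integer as Z using (+_; -[1+_])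
import Data.Integer.Properties as ZP
import Data.Integer.DivMod as ZD
import Data.Integer.Divisibility.Signed as ZS
open import Data.Integer.Tactic.RingSolver using (solve-∀)
open import Data.Product using (Σ; _×_; _,_)
open import Data.Sum using (inj₁; inj₂)
open import Data.Empty using (⊥-elim)
open import Relation.Nullary using (¬_; yes; no)
open import Function.Bundles using (mk⇔)
open import Data.List using (List; []; _∷_; _++_; map; length; cartesianProductWith)
import Data.List.Properties as LP
open import Data.List.Membership.Propositional using (_∈_; _∉_)
open import Data.List.Membership.Propositional.Properties
  using (∈-++⁺ˡ; ∈-++⁺ʳ; ∈-++⁻; ∈-cartesianProductWith⁺; ∈-cartesianProductWith⁻; ∈-deduplicate⁺; ∈-deduplicate⁻)
open import Data.List.Membership.Propositional.Properties.WithK using (unique∧set⇒bag)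
open import Data.List.Membership.DecPropositional _≟T_ using (_∈?_)
open import Data.List.Relation.Unary.Any using (here)
open import Data.List.Relation.Unary.Unique.Propositional using (Unique)
import Data.List.Relation.Unary.Unique.Propositional.Properties as Unique
open import Data.List.Relation.Unary.Unique.DecPropositional.Properties _≟T_ using (deduplicate-!)
open import Data.List.Relation.Binary.Permutation.Propositional as Perm using (_↭_; prep; swap)
import Data.List.Relation.Binary.Permutation.Propositional.Properties as Perm
open import Data.List.Relation.Binary.BagAndSetEquality using (∼bag⇒↭)
open import Level using (0ℓ)
open import Relation.Binary.Bundles using (Setoid)
import Relation.Binary.Reasoning.Setoid as SetoidReasoning
open import Relation.Binary.PropositionalEquality
  using (refl; sym; trans; cong; cong₂; _≗_; module ≡-Reasoning)

divide-exact : ∀ {d} → 0 < d → ∀ q → (+ d Z.* q) ÷ℤ d ≡ q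
divide-exact {suc d} _ (+ n) = begin
  (+ suc d Z.* + n) ÷ℤ suc d  ≡⟨ cong (_÷ℤ suc d) (sym (ZP.pos-* (suc d) n)) ⟩
  + (suc d * n N./ suc d)     ≡⟨ cong (λ k → + (k N./ suc d)) (NP.*-comm (suc d) n) ⟩
  + (n * suc d N./ suc d)     ≡⟨ cong +_ (ND.m*n/n≡m n (suc d)) ⟩
  + n                         ∎
  where open ≡-Reasoning
-- For q < 0 the dividend is -[1+ n + d(n+1)], whose absolute value is a multiple of
-- d+1, so only the zero-remainder branch of _/ℕ_ is reachable.
divide-exact {suc d} _ -[1+ n ] with suc (n + d * suc n) N.% suc d in rem
... | zero = cong (λ k → Z.- (+ k)) quotient
  where
  product : suc (n + d * suc n) ≡ suc n * suc d
  product = NP.*-comm (suc d) (suc n)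
  quotient : suc (n + d * suc n) N./ suc d ≡ suc n
  quotient = trans (cong (N._/ suc d) product) (ND.m*n/n≡m (suc n) (suc d))
... | suc _ = ⊥-elim (NP.0≢1+n (trans (sym (ND.m*n%n≡0 (suc n) (suc d)))
                                   (trans (cong (N._% suc d) (sym (NP.*-comm (suc d) (suc n)))) rem)))

pow2 : ℕ → ℤ
pow2 n = + (2 N.^ n)

pow2-suc : ∀ n → pow2 (suc n) ≡ + 2 Z.* pow2 n
pow2-suc n = ZP.pos-* 2 (2 N.^ n)

pow2-cancel : ∀ n {a b} → pow2 n Z.* a ≡ pow2 n Z.* b → a ≡ b
pow2-cancel n {a} {b} = ZP.*-cancelˡ-≡ (pow2 n) a b {{NP.m^n≢0 2 n}}

infix 4 _≈₂_
record _≈₂_ (a b : ℤ) : Set where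
  constructor mod2
  field
    quotient : ℤ
    difference : a Z.- b ≡ + 2 Z.* quotient

≈₂-reflexive : ∀ {a b} → a ≡ b → a ≈₂ b
≈₂-reflexive {a} refl = mod2 (+ 0) (ZP.+-inverseʳ a)

≈₂-sym : ∀ {a b} → a ≈₂ b → b ≈₂ a
≈₂-sym {a} {b} (mod2 k e) = mod2 (Z.- k) (trans (flip-difference a b) (trans (cong Z.-_ e) (ZP.neg-distribʳ-* (+ 2) k)))
  where flip-difference : ∀ (a b : ℤ) → b Z.- a ≡ Z.- (a Z.- b)
        flip-difference = solve-∀

≈₂-trans : ∀ {a b c} → a ≈₂ b → b ≈₂ c → a ≈₂ c
≈₂-trans {a} {b} {c} (mod2 k e) (mod2 l f) =
  mod2 (k Z.+ l) (trans (split a b c) (trans (cong₂ Z._+_ e f) (sym (ZP.*-distribˡ-+ (+ 2) k l))))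
  where split : ∀ (a b c : ℤ) → a Z.- c ≡ (a Z.- b) Z.+ (b Z.- c)
        split = solve-∀

≈₂-+ : ∀ {a b c d} → a ≈₂ b → c ≈₂ d → a Z.+ c ≈₂ b Z.+ d
≈₂-+ {a} {b} {c} {d} (mod2 k e) (mod2 l f) =
  mod2 (k Z.+ l) (trans (split a b c d) (trans (cong₂ Z._+_ e f) (sym (ZP.*-distribˡ-+ (+ 2) k l))))
  where split : ∀ (a b c d : ℤ) → (a Z.+ c) Z.- (b Z.+ d) ≡ (a Z.- b) Z.+ (c Z.- d)
        split = solve-∀

≈₂-* : ∀ {a b c d} → a ≈₂ b → c ≈₂ d → a Z.* c ≈₂ b Z.* d
≈₂-* {a} {b} {c} {d} (mod2 k e) (mod2 l f) =
  mod2 (k Z.* c Z.+ b Z.* l) (trans (split a b c d) (trans (cong₂ (λ u v → u Z.* c Z.+ b Z.* v) e f) (factor k l b c)))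
  where split : ∀ (a b c d : ℤ) → a Z.* c Z.- b Z.* d ≡ (a Z.- b) Z.* c Z.+ b Z.* (c Z.- d)
        split = solve-∀
        factor : ∀ (k l b c : ℤ) → (+ 2 Z.* k) Z.* c Z.+ b Z.* (+ 2 Z.* l) ≡ + 2 Z.* (k Z.* c Z.+ b Z.* l)
        factor = solve-∀

≈₂-drop-even : ∀ a k → a Z.+ + 2 Z.* k ≈₂ a
≈₂-drop-even a k = mod2 k (cancel a k)
  where cancel : ∀ (a k : ℤ) → a Z.+ + 2 Z.* k Z.- a ≡ + 2 Z.* k
        cancel = solve-∀

≈₂-setoid : Setoid 0ℓ 0ℓ
≈₂-setoid = record
  { Carrier = ℤ
  ; _≈_ = _≈₂_
  ; isEquivalence = record { refl = ≈₂-reflexive refl ; sym = ≈₂-sym ; trans = ≈₂-trans }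
  }

module ≈₂-Reasoning = SetoidReasoning ≈₂-setoid

≈₂-remainder : ∀ z → z ≈₂ + (z Z.%ℕ 2)
≈₂-remainder z = mod2 (z Z./ℕ 2)
  (trans (cong (Z._- + (z Z.%ℕ 2)) (ZD.a≡a%ℕn+[a/ℕn]*n z 2)) (cancel (+ (z Z.%ℕ 2)) (z Z./ℕ 2)))
  where cancel : ∀ (r q : ℤ) → r Z.+ q Z.* + 2 Z.- r ≡ + 2 Z.* q
        cancel = solve-∀

1-odd : ∀ k → ¬ (+ 1 ≡ + 2 Z.* k)
1-odd (+ 0) ()
1-odd (+ suc zero) ()
1-odd (+ suc (suc n)) ()
1-odd -[1+ n ] ()

≈₂-remainders : ∀ a b → a < 2 → b < 2 → + a ≈₂ + b → a ≡ b
≈₂-remainders 0 0 _ _ _ = refl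
≈₂-remainders 0 1 _ _ p = ⊥-elim (1-odd _ (_≈₂_.difference (≈₂-sym p)))
≈₂-remainders 1 0 _ _ p = ⊥-elim (1-odd _ (_≈₂_.difference p))
≈₂-remainders 1 1 _ _ _ = refl
≈₂-remainders (suc (suc a)) _ (s≤s (s≤s ())) _ _
≈₂-remainders _ (suc (suc b)) _ (s≤s (s≤s ())) _

≈₂⇒%2≡ : ∀ {x y} → x ≈₂ y → x Z.%ℕ 2 ≡ y Z.%ℕ 2
≈₂⇒%2≡ {x} {y} x≈y = ≈₂-remainders _ _ (ZD.n%ℕd<d x 2) (ZD.n%ℕd<d y 2)
  (≈₂-trans (≈₂-sym (≈₂-remainder x)) (≈₂-trans x≈y (≈₂-remainder y)))

infixl 7 _·_
infixl 6 _⊕_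
_·_ _⊕_ : (ℕ → ℤ) → (ℕ → ℤ) → ℕ → ℤ
(f · g) y = f y Z.* g y
(f ⊕ g) y = f y Z.+ g y

Δ-cong : ∀ {f g} → f ≗ g → Δ f ≗ Δ g
Δ-cong f≗g x = cong₂ Z._-_ (f≗g (suc x)) (f≗g x)

Δ^-cong : ∀ n {f g} → f ≗ g → Δ^ n f ≗ Δ^ n g
Δ^-cong zero f≗g = f≗g
Δ^-cong (suc n) f≗g = Δ-cong (Δ^-cong n f≗g)

Δ^-suc : ∀ n f → Δ^ (suc n) f ≗ Δ^ n (Δ f)
Δ^-suc zero f x = refl
Δ^-suc (suc n) f = Δ-cong (Δ^-suc n f)

Δ^-⊕ : ∀ n f g → Δ^ n (f ⊕ g) ≗ Δ^ n f ⊕ Δ^ n g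
Δ^-⊕ zero f g x = refl
Δ^-⊕ (suc n) f g x = trans (Δ-cong (Δ^-⊕ n f g) x) (regroup (Δ^ n f (suc x)) (Δ^ n g (suc x)) (Δ^ n f x) (Δ^ n g x))
  where regroup : ∀ (a b c d : ℤ) → (a Z.+ b) Z.- (c Z.+ d) ≡ (a Z.- c) Z.+ (b Z.- d)
        regroup = solve-∀

Δ^-scale : ∀ n c f → Δ^ n (λ y → c Z.* f y) ≗ (λ y → c Z.* Δ^ n f y)
Δ^-scale zero c f x = refl
Δ^-scale (suc n) c f x = trans (Δ-cong (Δ^-scale n c f) x) (factor c (Δ^ n f (suc x)) (Δ^ n f x))
  where factor : ∀ (c a b : ℤ) → c Z.* a Z.- c Z.* b ≡ c Z.* (a Z.- b)
        factor = solve-∀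

Δ^-const : ∀ n c x → Δ^ (suc n) (λ _ → c) x ≡ + 0
Δ^-const zero c x = ZP.+-inverseʳ c
Δ^-const (suc n) c x = Δ-cong (Δ^-const n c) x

Div2^ : ℕ → ℤ → Set
Div2^ n z = Σ ℤ λ q → z ≡ pow2 n Z.* q

InF′ : (ℕ → ℤ) → Set
InF′ f = ∀ n x → Div2^ n (Δ^ n f x)

InF⇒InF′ : ∀ {f} → InF f → InF′ f
InF⇒InF′ {f} f∈F n x with ZS.∣ᵤ⇒∣ {pow2 n} {Δ^ n f x} (f∈F n x)
... | ZS.divides q eq = q , trans eq (ZP.*-comm q (pow2 n))

InF′-cong : ∀ {f g} → f ≗ g → InF′ f → InF′ g
InF′-cong f≗g f∈F n x with f∈F n x
... | q , eq = q , trans (sym (Δ^-cong n f≗g x)) eq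

InF′-const : ∀ c → InF′ (λ _ → c)
InF′-const c zero x = c , sym (ZP.*-identityˡ c)
InF′-const c (suc n) x = + 0 , trans (Δ^-const n c x) (sym (ZP.*-zeroʳ (pow2 (suc n))))

InF′-⊕ : ∀ {f g} → InF′ f → InF′ g → InF′ (f ⊕ g)
InF′-⊕ {f} {g} f∈F g∈F n x with f∈F n x | g∈F n x
... | p , ep | q , eq = p Z.+ q ,
  trans (Δ^-⊕ n f g x) (trans (cong₂ Z._+_ ep eq) (sym (ZP.*-distribˡ-+ (pow2 n) p q)))

digit : ℕ → (ℕ → ℤ) → ℕ → ℤ
digit n f x = Δ^ n f x ÷ℤ (2 N.^ n)

digit-spec : ∀ {f} → InF′ f → ∀ n x → Δ^ n f x ≡ pow2 n Z.* digit n f x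
digit-spec {f} f∈F n x with f∈F n x
... | q , eq = trans eq (cong (pow2 n Z.*_) (sym (trans (cong (_÷ℤ (2 N.^ n)) eq) (divide-exact (NP.m^n>0 2 n) q))))

digit-zero : ∀ f x → digit 0 f x ≡ f x
digit-zero f x = trans (cong (_÷ℤ 1) (sym (ZP.*-identityˡ (f x)))) (divide-exact (s≤s z≤n) (f x))

digit-cong : ∀ n {f g} → f ≗ g → ∀ x → digit n f x ≡ digit n g x
digit-cong n f≗g x = cong (_÷ℤ (2 N.^ n)) (Δ^-cong n f≗g x)

digit-⊕ : ∀ {f g} → InF′ f → InF′ g → ∀ n x → digit n (f ⊕ g) x ≡ digit n f x Z.+ digit n g x
digit-⊕ {f} {g} f∈F g∈F n x = pow2-cancel n (begin
  pow2 n Z.* digit n (f ⊕ g) x                          ≡⟨ sym (digit-spec (InF′-⊕ f∈F g∈F) n x) ⟩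
  Δ^ n (f ⊕ g) x                                        ≡⟨ Δ^-⊕ n f g x ⟩
  Δ^ n f x Z.+ Δ^ n g x                                 ≡⟨ cong₂ Z._+_ (digit-spec f∈F n x) (digit-spec g∈F n x) ⟩
  pow2 n Z.* digit n f x Z.+ pow2 n Z.* digit n g x     ≡⟨ sym (ZP.*-distribˡ-+ (pow2 n) _ _) ⟩
  pow2 n Z.* (digit n f x Z.+ digit n g x)              ∎)
  where open ≡-Reasoning

D : (ℕ → ℤ) → ℕ → ℤ
D = digit 1

shift-by-D : ∀ {f} → InF′ f → ∀ x → f (suc x) ≡ f x Z.+ + 2 Z.* D f x
shift-by-D {f} f∈F x = trans (split (f (suc x)) (f x)) (cong (λ d → f x Z.+ d) (digit-spec f∈F 1 x))
  where split : ∀ (a b : ℤ) → a ≡ b Z.+ (a Z.- b)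
        split = solve-∀

Δ^-D : ∀ {f} → InF′ f → ∀ n x → Δ^ (suc n) f x ≡ + 2 Z.* Δ^ n (D f) x
Δ^-D {f} f∈F n x = trans (Δ^-suc n f x) (trans (Δ^-cong n (digit-spec f∈F 1) x) (Δ^-scale n (+ 2) (D f) x))

InF′-D : ∀ {f} → InF′ f → InF′ (D f)
InF′-D {f} f∈F n x with f∈F (suc n) x
... | q , eq = q , ZP.*-cancelˡ-≡ (+ 2) _ _
  (trans (sym (Δ^-D f∈F n x)) (trans eq (trans (cong (Z._* q) (pow2-suc n)) (ZP.*-assoc (+ 2) (pow2 n) q))))

digit-D : ∀ {f} → InF′ f → ∀ n x → digit n (D f) x ≡ digit (suc n) f x
digit-D {f} f∈F n x = pow2-cancel (suc n) (begin
  pow2 (suc n) Z.* digit n (D f) x      ≡⟨ cong (Z._* digit n (D f) x) (pow2-suc n) ⟩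
  + 2 Z.* pow2 n Z.* digit n (D f) x    ≡⟨ ZP.*-assoc (+ 2) (pow2 n) _ ⟩
  + 2 Z.* (pow2 n Z.* digit n (D f) x)  ≡⟨ cong (+ 2 Z.*_) (sym (digit-spec (InF′-D f∈F) n x)) ⟩
  + 2 Z.* Δ^ n (D f) x                  ≡⟨ sym (Δ^-D f∈F n x) ⟩
  Δ^ (suc n) f x                        ≡⟨ digit-spec f∈F (suc n) x ⟩
  pow2 (suc n) Z.* digit (suc n) f x    ∎)
  where open ≡-Reasoning

Δ-· : ∀ {f g} → InF′ f → InF′ g →
      Δ (f · g) ≗ (λ y → + 2 Z.* (D f · g ⊕ f · D g) y) ⊕ (λ y → + 4 Z.* (D f · D g) y)
Δ-· {f} {g} f∈F g∈F y =
  trans (cong₂ (λ u v → u Z.* v Z.- f y Z.* g y) (shift-by-D f∈F y) (shift-by-D g∈F y))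
        (expand (f y) (g y) (D f y) (D g y))
  where expand : ∀ (a b d e : ℤ) → (a Z.+ + 2 Z.* d) Z.* (b Z.+ + 2 Z.* e) Z.- a Z.* b
                                   ≡ + 2 Z.* (d Z.* b Z.+ a Z.* e) Z.+ + 4 Z.* (d Z.* e)
        expand = solve-∀

Δ^-suc-· : ∀ {f g} → InF′ f → InF′ g → ∀ n x {a b c} →
           Δ^ n (D f · g) x ≡ pow2 n Z.* a → Δ^ n (f · D g) x ≡ pow2 n Z.* b →
           Δ^ n (D f · D g) x ≡ pow2 n Z.* c →
           Δ^ (suc n) (f · g) x ≡ pow2 (suc n) Z.* (a Z.+ b Z.+ + 2 Z.* c)
Δ^-suc-· {f} {g} f∈F g∈F n x {a} {b} {c} ea eb ec = begin
  Δ^ (suc n) (f · g) x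
    ≡⟨ trans (Δ^-suc n (f · g) x) (Δ^-cong n (Δ-· f∈F g∈F) x) ⟩
  Δ^ n ((λ y → + 2 Z.* (D f · g ⊕ f · D g) y) ⊕ (λ y → + 4 Z.* (D f · D g) y)) x
    ≡⟨ Δ^-⊕ n (λ y → + 2 Z.* (D f · g ⊕ f · D g) y) (λ y → + 4 Z.* (D f · D g) y) x ⟩
  Δ^ n (λ y → + 2 Z.* (D f · g ⊕ f · D g) y) x Z.+ Δ^ n (λ y → + 4 Z.* (D f · D g) y) x
    ≡⟨ cong₂ Z._+_ (trans (Δ^-scale n (+ 2) (D f · g ⊕ f · D g) x) (cong (+ 2 Z.*_) (Δ^-⊕ n (D f · g) (f · D g) x)))
                   (Δ^-scale n (+ 4) (D f · D g) x) ⟩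
  + 2 Z.* (Δ^ n (D f · g) x Z.+ Δ^ n (f · D g) x) Z.+ + 4 Z.* Δ^ n (D f · D g) x
    ≡⟨ cong₂ (λ u v → + 2 Z.* u Z.+ + 4 Z.* v) (cong₂ Z._+_ ea eb) ec ⟩
  + 2 Z.* (pow2 n Z.* a Z.+ pow2 n Z.* b) Z.+ + 4 Z.* (pow2 n Z.* c)
    ≡⟨ regroup (pow2 n) a b c ⟩
  (+ 2 Z.* pow2 n) Z.* (a Z.+ b Z.+ + 2 Z.* c)
    ≡⟨ cong (Z._* (a Z.+ b Z.+ + 2 Z.* c)) (sym (pow2-suc n)) ⟩
  pow2 (suc n) Z.* (a Z.+ b Z.+ + 2 Z.* c) ∎
  where
  open ≡-Reasoning
  regroup : ∀ (p a b c : ℤ) → + 2 Z.* (p Z.* a Z.+ p Z.* b) Z.+ + 4 Z.* (p Z.* c)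
                              ≡ (+ 2 Z.* p) Z.* (a Z.+ b Z.+ + 2 Z.* c)
  regroup = solve-∀

InF′-· : ∀ {f g} → InF′ f → InF′ g → InF′ (f · g)
InF′-· {f} {g} f∈F g∈F zero x = (f · g) x , sym (ZP.*-identityˡ _)
InF′-· {f} {g} f∈F g∈F (suc n) x
  with InF′-· (InF′-D f∈F) g∈F n x | InF′-· f∈F (InF′-D g∈F) n x | InF′-· (InF′-D f∈F) (InF′-D g∈F) n x
... | a , ea | b , eb | c , ec = a Z.+ b Z.+ + 2 Z.* c , Δ^-suc-· f∈F g∈F n x ea eb ec

digit-suc-· : ∀ {f g} → InF′ f → InF′ g → ∀ m x →
              digit (suc m) (f · g) x
              ≡ digit m (D f · g) x Z.+ digit m (f · D g) x Z.+ + 2 Z.* digit m (D f · D g) x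
digit-suc-· {f} {g} f∈F g∈F m x = pow2-cancel (suc m)
  (trans (sym (digit-spec (InF′-· f∈F g∈F) (suc m) x))
         (Δ^-suc-· f∈F g∈F m x (digit-spec (InF′-· Df∈F g∈F) m x) (digit-spec (InF′-· f∈F Dg∈F) m x)
                                (digit-spec (InF′-· Df∈F Dg∈F) m x)))
  where
  Df∈F : InF′ (D f)
  Df∈F = InF′-D f∈F
  Dg∈F : InF′ (D g)
  Dg∈F = InF′-D g∈F

-- pascalSum m F = Σ_{i+j=m} C(m,i)·F(i,j), defined by Pascal's rule; this is the
-- shape in which the Leibniz rule arises.
pascalSum : ℕ → (ℕ → ℕ → ℤ) → ℤ
pascalSum zero F = F 0 0
pascalSum (suc m) F = pascalSum m (λ i j → F (suc i) j) Z.+ pascalSum m (λ i j → F i (suc j))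

pascalSum-cong : ∀ m {F G} → (∀ i j → F i j ≡ G i j) → pascalSum m F ≡ pascalSum m G
pascalSum-cong zero F≡G = F≡G 0 0
pascalSum-cong (suc m) F≡G =
  cong₂ Z._+_ (pascalSum-cong m (λ i j → F≡G (suc i) j)) (pascalSum-cong m (λ i j → F≡G i (suc j)))

pascalSum-≈₂ : ∀ m {F G} → (∀ i j → F i j ≈₂ G i j) → pascalSum m F ≈₂ pascalSum m G
pascalSum-≈₂ zero F≈G = F≈G 0 0
pascalSum-≈₂ (suc m) F≈G = ≈₂-+ (pascalSum-≈₂ m (λ i j → F≈G (suc i) j)) (pascalSum-≈₂ m (λ i j → F≈G i (suc j)))

pascalSum-+ : ∀ m F G → pascalSum m F Z.+ pascalSum m G ≡ pascalSum m (λ i j → F i j Z.+ G i j)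
pascalSum-+ zero F G = refl
pascalSum-+ (suc m) F G =
  trans (regroup (pascalSum m (λ i j → F (suc i) j)) (pascalSum m (λ i j → F i (suc j)))
                 (pascalSum m (λ i j → G (suc i) j)) (pascalSum m (λ i j → G i (suc j))))
        (cong₂ Z._+_ (pascalSum-+ m _ _) (pascalSum-+ m _ _))
  where regroup : ∀ (a b c d : ℤ) → a Z.+ b Z.+ (c Z.+ d) ≡ (a Z.+ c) Z.+ (b Z.+ d)
        regroup = solve-∀

pascalSum-scaleʳ : ∀ m F c → pascalSum m F Z.* c ≡ pascalSum m (λ i j → F i j Z.* c)
pascalSum-scaleʳ zero F c = refl
pascalSum-scaleʳ (suc m) F c = trans (ZP.*-distribʳ-+ c (pascalSum m (λ i j → F (suc i) j)) (pascalSum m (λ i j → F i (suc j))))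
  (cong₂ Z._+_ (pascalSum-scaleʳ m (λ i j → F (suc i) j) c) (pascalSum-scaleʳ m (λ i j → F i (suc j)) c))

leibniz-mod2 : ∀ m {f g} → InF′ f → InF′ g → ∀ x →
               digit m (f · g) x ≈₂ pascalSum m (λ i j → digit i f x Z.* digit j g x)
leibniz-mod2 zero {f} {g} f∈F g∈F x =
  ≈₂-reflexive (trans (digit-zero (f · g) x) (sym (cong₂ Z._*_ (digit-zero f x) (digit-zero g x))))
leibniz-mod2 (suc m) {f} {g} f∈F g∈F x = begin
  digit (suc m) (f · g) x
    ≡⟨ digit-suc-· f∈F g∈F m x ⟩
  digit m (D f · g) x Z.+ digit m (f · D g) x Z.+ + 2 Z.* digit m (D f · D g) x
    ≈⟨ ≈₂-drop-even _ _ ⟩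
  digit m (D f · g) x Z.+ digit m (f · D g) x
    ≈⟨ ≈₂-+ (leibniz-mod2 m (InF′-D f∈F) g∈F x) (leibniz-mod2 m f∈F (InF′-D g∈F) x) ⟩
  pascalSum m (λ i j → digit i (D f) x Z.* digit j g x) Z.+ pascalSum m (λ i j → digit i f x Z.* digit j (D g) x)
    ≡⟨ cong₂ Z._+_ (pascalSum-cong m (λ i j → cong (Z._* digit j g x) (digit-D f∈F i x)))
                   (pascalSum-cong m (λ i j → cong (digit i f x Z.*_) (digit-D g∈F j x))) ⟩
  pascalSum (suc m) (λ i j → digit i f x Z.* digit j g x) ∎
  where open ≈₂-Reasoning

Σℤ : ℕ → (ℕ → ℤ) → ℤ
Σℤ zero f = + 0
Σℤ (suc n) f = Σℤ n f Z.+ f n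

Σℤ-cong : ∀ n {f g} → (∀ i → i < n → f i ≡ g i) → Σℤ n f ≡ Σℤ n g
Σℤ-cong zero f≡g = refl
Σℤ-cong (suc n) f≡g = cong₂ Z._+_ (Σℤ-cong n (λ i i<n → f≡g i (NP.m<n⇒m<1+n i<n))) (f≡g n (NP.n<1+n n))

Σℤ-+ : ∀ n f g → Σℤ n (λ i → f i Z.+ g i) ≡ Σℤ n f Z.+ Σℤ n g
Σℤ-+ zero f g = refl
Σℤ-+ (suc n) f g = trans (cong (Z._+ (f n Z.+ g n)) (Σℤ-+ n f g)) (regroup (Σℤ n f) (Σℤ n g) (f n) (g n))
  where regroup : ∀ (a b c d : ℤ) → a Z.+ b Z.+ (c Z.+ d) ≡ a Z.+ c Z.+ (b Z.+ d)
        regroup = solve-∀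

Σℤ-scale : ∀ n c f → Σℤ n (λ i → c Z.* f i) ≡ c Z.* Σℤ n f
Σℤ-scale zero c f = sym (ZP.*-zeroʳ c)
Σℤ-scale (suc n) c f = trans (cong (Z._+ c Z.* f n) (Σℤ-scale n c f)) (sym (ZP.*-distribˡ-+ c (Σℤ n f) (f n)))

Σℤ-head : ∀ n f → Σℤ (suc n) f ≡ f 0 Z.+ Σℤ n (λ i → f (suc i))
Σℤ-head zero f = trans (ZP.+-identityˡ (f 0)) (sym (ZP.+-identityʳ (f 0)))
Σℤ-head (suc n) f = trans (cong (Z._+ f (suc n)) (Σℤ-head n f)) (ZP.+-assoc (f 0) _ _)

+-Σ< : ∀ n f → + (Σ< n f) ≡ Σℤ n (λ i → + f i)
+-Σ< zero f = refl
+-Σ< (suc n) f = trans (ZP.pos-+ (Σ< n f) (f n)) (cong (Z._+ + f n) (+-Σ< n f))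

+-Σtriple : ∀ m f → + Σtriple m f ≡ Σℤ (suc m) (λ i → Σℤ (suc (m ∸ i)) (λ j → + f i j (m ∸ i ∸ j)))
+-Σtriple m f = trans (+-Σ< (suc m) _) (Σℤ-cong (suc m) (λ i _ → +-Σ< (suc (m ∸ i)) _))

Σtriple-cong : ∀ m {f g} → (∀ i j k → f i j k ≡ g i j k) → Σtriple m f ≡ Σtriple m g
Σtriple-cong m f≡g = Σ<-cong (suc m) (λ i → Σ<-cong (suc (m ∸ i)) (λ j → f≡g i j (m ∸ i ∸ j)))
  where
  Σ<-cong : ∀ n {u v : ℕ → ℕ} → (∀ i → u i ≡ v i) → Σ< n u ≡ Σ< n v
  Σ<-cong zero u≡v = refl
  Σ<-cong (suc n) u≡v = cong₂ _+_ (Σ<-cong n u≡v) (u≡v n)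

∸-suc : ∀ m i → i < m → m ∸ i ≡ suc (m ∸ suc i)
∸-suc (suc m) zero _ = refl
∸-suc (suc m) (suc i) (s≤s i<m) = ∸-suc m i i<m

-- In the inductive step the two shifted sums recombine by Pascal's rule; the
-- first term is F(0, m+1) and the last one carries C(m, m+1) = 0.
pascalSum-binomial : ∀ m F → pascalSum m F ≡ Σℤ (suc m) (λ i → + (m C i) Z.* F i (m ∸ i))
pascalSum-binomial zero F = sym (trans (ZP.+-identityˡ _) (ZP.*-identityˡ (F 0 0)))
pascalSum-binomial (suc m) F = begin
  pascalSum m (λ i j → F (suc i) j) Z.+ pascalSum m (λ i j → F i (suc j))
    ≡⟨ cong₂ Z._+_ (pascalSum-binomial m _) (pascalSum-binomial m _) ⟩
  left Z.+ Σℤ (suc m) (λ i → + (m C i) Z.* F i (suc (m ∸ i)))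
    ≡⟨ cong (λ s → left Z.+ s) (Σℤ-head m _) ⟩
  left Z.+ (first Z.+ Σℤ m (λ i → + (m C suc i) Z.* F (suc i) (suc (m ∸ suc i))))
    ≡⟨ cong (λ s → left Z.+ (first Z.+ s))
            (Σℤ-cong m (λ i i<m → cong (λ k → + (m C suc i) Z.* F (suc i) k) (sym (∸-suc m i i<m)))) ⟩
  left Z.+ (first Z.+ right)
    ≡⟨ regroup left first right (F (suc m) 0) ⟩
  first Z.+ (left Z.+ (right Z.+ + 0 Z.* F (suc m) 0))
    ≡⟨ cong (λ c → first Z.+ (left Z.+ (right Z.+ + c Z.* F (suc m) (m ∸ m))))
            (sym (k>n⇒nCk≡0 (NP.n<1+n m))) ⟩
  first Z.+ (left Z.+ Σℤ (suc m) (λ i → + (m C suc i) Z.* F (suc i) (m ∸ i)))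
    ≡⟨ cong (λ s → first Z.+ s) (sym (Σℤ-+ (suc m) _ _)) ⟩
  first Z.+ Σℤ (suc m) (λ i → + (m C i) Z.* F (suc i) (m ∸ i) Z.+ + (m C suc i) Z.* F (suc i) (m ∸ i))
    ≡⟨ cong (λ s → first Z.+ s) (Σℤ-cong (suc m) (λ i _ → pascal i)) ⟩
  first Z.+ Σℤ (suc m) (λ i → + (suc m C suc i) Z.* F (suc i) (suc m ∸ suc i))
    ≡⟨ sym (Σℤ-head (suc m) (λ i → + (suc m C i) Z.* F i (suc m ∸ i))) ⟩
  Σℤ (suc (suc m)) (λ i → + (suc m C i) Z.* F i (suc m ∸ i)) ∎
  where
  open ≡-Reasoning
  first left right : ℤ
  first = + 1 Z.* F 0 (suc m)
  left = Σℤ (suc m) (λ i → + (m C i) Z.* F (suc i) (m ∸ i))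
  right = Σℤ m (λ i → + (m C suc i) Z.* F (suc i) (m ∸ i))
  regroup : ∀ (l a r c : ℤ) → l Z.+ (a Z.+ r) ≡ a Z.+ (l Z.+ (r Z.+ + 0 Z.* c))
  regroup = solve-∀
  pascal : ∀ i → + (m C i) Z.* F (suc i) (m ∸ i) Z.+ + (m C suc i) Z.* F (suc i) (m ∸ i)
                 ≡ + (suc m C suc i) Z.* F (suc i) (suc m ∸ suc i)
  pascal i = trans (sym (ZP.*-distribʳ-+ (F (suc i) (m ∸ i)) (+ (m C i)) (+ (m C suc i))))
                   (cong (Z._* F (suc i) (m ∸ i))
                         (trans (sym (ZP.pos-+ (m C i) (m C suc i))) (cong +_ (nCk+nC[k+1]≡[n+1]C[k+1] m i))))

Σℤ-triangle : ∀ m (G : ℕ → ℕ → ℤ) →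
              Σℤ (suc m) (λ n → Σℤ (suc n) (λ i → G i (n ∸ i))) ≡ Σℤ (suc m) (λ i → Σℤ (suc (m ∸ i)) (G i))
Σℤ-triangle zero G = refl
Σℤ-triangle (suc m) G = begin
  Σℤ (suc m) (λ n → Σℤ (suc n) (λ i → G i (n ∸ i))) Z.+ (diagonal Z.+ G (suc m) (m ∸ m))
    ≡⟨ cong₂ (λ s k → s Z.+ (diagonal Z.+ G (suc m) k)) (Σℤ-triangle m G) (NP.n∸n≡0 m) ⟩
  Σℤ (suc m) (λ i → Σℤ (suc (m ∸ i)) (G i)) Z.+ (diagonal Z.+ G (suc m) 0)
    ≡⟨ regroup (Σℤ (suc m) (λ i → Σℤ (suc (m ∸ i)) (G i))) diagonal (G (suc m) 0) ⟩
  Σℤ (suc m) (λ i → Σℤ (suc (m ∸ i)) (G i)) Z.+ diagonal Z.+ Σℤ 1 (G (suc m))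
    ≡⟨ cong₂ Z._+_ (sym (Σℤ-+ (suc m) _ _)) (cong (λ k → Σℤ (suc k) (G (suc m))) (sym (NP.n∸n≡0 m))) ⟩
  Σℤ (suc m) (λ i → Σℤ (suc (m ∸ i)) (G i) Z.+ G i (suc m ∸ i)) Z.+ Σℤ (suc (m ∸ m)) (G (suc m))
    ≡⟨ cong (Z._+ Σℤ (suc (m ∸ m)) (G (suc m))) (Σℤ-cong (suc m) extend-row) ⟩
  Σℤ (suc (suc m)) (λ i → Σℤ (suc (suc m ∸ i)) (G i)) ∎
  where
  open ≡-Reasoning
  diagonal : ℤ
  diagonal = Σℤ (suc m) (λ i → G i (suc m ∸ i))
  regroup : ∀ (u a c : ℤ) → u Z.+ (a Z.+ c) ≡ u Z.+ a Z.+ (+ 0 Z.+ c)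
  regroup = solve-∀
  extend-row : ∀ i → i < suc m → Σℤ (suc (m ∸ i)) (G i) Z.+ G i (suc m ∸ i) ≡ Σℤ (suc (suc m ∸ i)) (G i)
  extend-row i (s≤s i≤m) rewrite NP.+-∸-assoc 1 i≤m = refl

factorial-split : ∀ {n k} → k ≤ n → n ! ≡ (n C k) * (k ! * (n ∸ k) !)
factorial-split {n} {k} k≤n = sym (trans (cong (_* (k ! * (n ∸ k) !)) (nCk≡n!/k![n-k]! k≤n))
                                         (ND.m/n*n≡m {{NP._!*_!≢0 k (n ∸ k)}} (k![n∸k]!∣n! k≤n)))

multinomial-binomials : ∀ m i j → i + j ≤ m → multinomial m i j (m ∸ i ∸ j) ≡ (m C (i + j)) * ((i + j) C i)
multinomial-binomials m i j i+j≤m = trans (cong (_÷ℕ denominator) factorials) (cancel _ denominator positive)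
  where
  denominator : ℕ
  denominator = i ! * j ! * (m ∸ i ∸ j) !
  positive : 0 < denominator
  positive = NP.*-mono-≤ (NP.*-mono-≤ (NP.1≤n! i) (NP.1≤n! j)) (NP.1≤n! (m ∸ i ∸ j))
  cancel : ∀ c d → 0 < d → (c * d) ÷ℕ d ≡ c
  cancel c (suc d) _ = ND.m*n/n≡m c (suc d)
  regroup : ∀ (c c′ a b d : ℕ) → c * ((c′ * (a * b)) * d) ≡ (c * c′) * (a * b * d)
  regroup = ℕSolver.solve-∀
  factorials : m ! ≡ (m C (i + j)) * ((i + j) C i) * denominator
  factorials = trans (factorial-split i+j≤m)
    (trans (cong (λ z → (m C (i + j)) * (z * (m ∸ (i + j)) !)) (factorial-split (NP.m≤m+n i j)))
    (trans (cong₂ (λ u v → (m C (i + j)) * (((i + j) C i) * (i ! * u !) * v !)) (NP.m+n∸m≡n i j) (sym (NP.∸-+-assoc m i j)))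
           (regroup (m C (i + j)) ((i + j) C i) (i !) (j !) ((m ∸ i ∸ j) !))))

+-product : ∀ a b c → + a Z.* (+ b Z.* + c) ≡ + (a * b * c)
+-product a b c = trans (cong (+ a Z.*_) (sym (ZP.pos-* b c)))
                        (trans (sym (ZP.pos-* a (b * c))) (cong +_ (sym (NP.*-assoc a b c))))

pascalSum-nested : ∀ m (h : ℕ → ℕ → ℕ → ℕ) →
                   pascalSum m (λ n k → pascalSum n (λ i j → + h i j k))
                   ≡ + Σtriple m (λ i j k → multinomial m i j k * h i j k)
pascalSum-nested m h = begin
  pascalSum m (λ n k → pascalSum n (λ i j → + h i j k))
    ≡⟨ pascalSum-binomial m _ ⟩
  Σℤ (suc m) (λ n → + (m C n) Z.* pascalSum n (λ i j → + h i j (m ∸ n)))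
    ≡⟨ Σℤ-cong (suc m) (λ n _ → expand-row n) ⟩
  Σℤ (suc m) (λ n → Σℤ (suc n) (λ i → G i (n ∸ i)))
    ≡⟨ Σℤ-triangle m G ⟩
  Σℤ (suc m) (λ i → Σℤ (suc (m ∸ i)) (G i))
    ≡⟨ Σℤ-cong (suc m) (λ i i<1+m → Σℤ-cong (suc (m ∸ i)) (λ j j<1+m∸i →
         G-multinomial i j (NP.≤-pred i<1+m) (NP.≤-pred j<1+m∸i))) ⟩
  Σℤ (suc m) (λ i → Σℤ (suc (m ∸ i)) (λ j → + (multinomial m i j (m ∸ i ∸ j) * h i j (m ∸ i ∸ j))))
    ≡⟨ sym (+-Σtriple m (λ i j k → multinomial m i j k * h i j k)) ⟩
  + Σtriple m (λ i j k → multinomial m i j k * h i j k) ∎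
  where
  open ≡-Reasoning
  G : ℕ → ℕ → ℤ
  G i j = + ((m C (i + j)) * ((i + j) C i) * h i j (m ∸ (i + j)))
  G-at : ∀ {i j n} → i + j ≡ n → G i j ≡ + ((m C n) * (n C i) * h i j (m ∸ n))
  G-at refl = refl
  expand-row : ∀ n → + (m C n) Z.* pascalSum n (λ i j → + h i j (m ∸ n)) ≡ Σℤ (suc n) (λ i → G i (n ∸ i))
  expand-row n = begin
    + (m C n) Z.* pascalSum n (λ i j → + h i j (m ∸ n))
      ≡⟨ cong (+ (m C n) Z.*_) (pascalSum-binomial n _) ⟩
    + (m C n) Z.* Σℤ (suc n) (λ i → + (n C i) Z.* + h i (n ∸ i) (m ∸ n))
      ≡⟨ sym (Σℤ-scale (suc n) (+ (m C n)) _) ⟩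
    Σℤ (suc n) (λ i → + (m C n) Z.* (+ (n C i) Z.* + h i (n ∸ i) (m ∸ n)))
      ≡⟨ Σℤ-cong (suc n) (λ i i<1+n → trans (+-product (m C n) (n C i) _)
                                             (sym (G-at (NP.m+[n∸m]≡n (NP.≤-pred i<1+n))))) ⟩
    Σℤ (suc n) (λ i → G i (n ∸ i)) ∎
  G-multinomial : ∀ i j → i ≤ m → j ≤ m ∸ i → G i j ≡ + (multinomial m i j (m ∸ i ∸ j) * h i j (m ∸ i ∸ j))
  G-multinomial i j i≤m j≤m∸i = cong +_ (cong₂ _*_ (sym (multinomial-binomials m i j i+j≤m))
                                                 (cong (h i j) (sym (NP.∸-+-assoc m i j))))
    where i+j≤m : i + j ≤ m
          i+j≤m = NP.≤-trans (NP.≤-reflexive (NP.+-comm i j)) (NP.m≤o∸n⇒m+n≤o j i≤m j≤m∸i)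

listSum : {A : Set} → (A → ℤ) → List A → ℤ
listSum g xs = sumℤ (map g xs)

sumℤ-↭ : ∀ {xs ys} → xs ↭ ys → sumℤ xs ≡ sumℤ ys
sumℤ-↭ Perm.refl = refl
sumℤ-↭ (prep x p) = cong (λ s → x Z.+ s) (sumℤ-↭ p)
sumℤ-↭ (swap {ys = ys} x y p) = trans (cong (λ s → x Z.+ (y Z.+ s)) (sumℤ-↭ p)) (exchange x y (sumℤ ys))
  where exchange : ∀ (a b c : ℤ) → a Z.+ (b Z.+ c) ≡ b Z.+ (a Z.+ c)
        exchange = solve-∀
sumℤ-↭ (Perm.trans p q) = trans (sumℤ-↭ p) (sumℤ-↭ q)

listSum-↭ : {A : Set} (g : A → ℤ) {xs ys : List A} → xs ↭ ys → listSum g xs ≡ listSum g ys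
listSum-↭ g p = sumℤ-↭ (Perm.map⁺ g p)

listSum-++ : {A : Set} (g : A → ℤ) (xs ys : List A) → listSum g (xs ++ ys) ≡ listSum g xs Z.+ listSum g ys
listSum-++ g [] ys = sym (ZP.+-identityˡ _)
listSum-++ g (x ∷ xs) ys = trans (cong (λ s → g x Z.+ s) (listSum-++ g xs ys)) (sym (ZP.+-assoc (g x) _ _))

listSum-cartesian : {A B C : Set} (F : A → B → C) (g : C → ℤ) (k : ℤ) (u : A → ℤ) (v : B → ℤ) →
                    (∀ a c → g (F a c) ≡ k Z.* (u a Z.* v c)) →
                    ∀ xs ys → listSum g (cartesianProductWith F xs ys) ≡ k Z.* (listSum u xs Z.* listSum v ys)
listSum-cartesian F g k u v g≡kuv [] ys = sym (ZP.*-zeroʳ k)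
listSum-cartesian F g k u v g≡kuv (x ∷ xs) ys = begin
  listSum g (map (F x) ys ++ cartesianProductWith F xs ys)
    ≡⟨ listSum-++ g (map (F x) ys) _ ⟩
  listSum g (map (F x) ys) Z.+ listSum g (cartesianProductWith F xs ys)
    ≡⟨ cong₂ Z._+_ (row ys) (listSum-cartesian F g k u v g≡kuv xs ys) ⟩
  k Z.* (u x Z.* listSum v ys) Z.+ k Z.* (listSum u xs Z.* listSum v ys)
    ≡⟨ collect k (u x) (listSum u xs) (listSum v ys) ⟩
  k Z.* ((u x Z.+ listSum u xs) Z.* listSum v ys) ∎
  where
  open ≡-Reasoning
  collect : ∀ (k a s t : ℤ) → k Z.* (a Z.* t) Z.+ k Z.* (s Z.* t) ≡ k Z.* ((a Z.+ s) Z.* t)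
  collect = solve-∀
  expand : ∀ (k a b t : ℤ) → k Z.* (a Z.* b) Z.+ k Z.* (a Z.* t) ≡ k Z.* (a Z.* (b Z.+ t))
  expand = solve-∀
  row : ∀ zs → listSum g (map (F x) zs) ≡ k Z.* (u x Z.* listSum v zs)
  row [] = sym (trans (cong (k Z.*_) (ZP.*-zeroʳ (u x))) (ZP.*-zeroʳ k))
  row (z ∷ zs) = trans (cong₂ Z._+_ (g≡kuv x z) (row zs)) (expand k (u x) (v z) (listSum v zs))

length-cartesian : {A B C : Set} (F : A → B → C) (xs : List A) (ys : List B) →
                   length (cartesianProductWith F xs ys) ≡ length xs * length ys
length-cartesian F [] ys = refl
length-cartesian F (x ∷ xs) ys =
  trans (LP.length-++ (map (F x) ys)) (cong₂ _+_ (LP.length-map (F x) ys) (length-cartesian F xs ys))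

same-members⇒↭ : {A : Set} {xs ys : List A} → Unique xs → Unique ys →
                 (∀ {z} → z ∈ xs → z ∈ ys) → (∀ {z} → z ∈ ys → z ∈ xs) → xs ↭ ys
same-members⇒↭ ux uy to from = ∼bag⇒↭ (unique∧set⇒bag ux uy (mk⇔ to from))

data FlipOfNode (tl tr s : Tree) : Set where
  unswapped : ∀ {a c} → a ∈ flips tl → c ∈ flips tr → s ≡ node a c → FlipOfNode tl tr s
  swapped   : ∀ {a c} → a ∈ flips tl → c ∈ flips tr → s ≡ node c a → FlipOfNode tl tr s

flip-node⁻ : ∀ tl tr {s} → s ∈ flips (node tl tr) → FlipOfNode tl tr s
flip-node⁻ tl tr s∈ with ∈-++⁻ (cartesianProductWith node (flips tl) (flips tr)) s∈
... | inj₁ p with ∈-cartesianProductWith⁻ node (flips tl) (flips tr) p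
...   | _ , _ , a∈ , c∈ , eq = unswapped a∈ c∈ eq
flip-node⁻ tl tr s∈ | inj₂ p with ∈-cartesianProductWith⁻ (λ a c → node c a) (flips tl) (flips tr) p
...   | _ , _ , a∈ , c∈ , eq = swapped a∈ c∈ eq

unswapped⁺ : ∀ tl tr {a c} → a ∈ flips tl → c ∈ flips tr → node a c ∈ flips (node tl tr)
unswapped⁺ tl tr a∈ c∈ = ∈-++⁺ˡ (∈-cartesianProductWith⁺ node a∈ c∈)

swapped⁺ : ∀ tl tr {a c} → a ∈ flips tl → c ∈ flips tr → node c a ∈ flips (node tl tr)
swapped⁺ tl tr a∈ c∈ = ∈-++⁺ʳ (cartesianProductWith node (flips tl) (flips tr)) (∈-cartesianProductWith⁺ (λ a c → node c a) a∈ c∈)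

flips-refl : ∀ t → t ∈ flips t
flips-refl leaf = here refl
flips-refl (node tl tr) = unswapped⁺ tl tr (flips-refl tl) (flips-refl tr)

flips-sym : ∀ t {s} → s ∈ flips t → t ∈ flips s
flips-sym leaf (here refl) = here refl
flips-sym (node tl tr) s∈ with flip-node⁻ tl tr s∈
... | unswapped {a} {c} a∈ c∈ refl = unswapped⁺ a c (flips-sym tl a∈) (flips-sym tr c∈)
... | swapped {a} {c} a∈ c∈ refl = swapped⁺ c a (flips-sym tr c∈) (flips-sym tl a∈)

flips-trans : ∀ t {s u} → s ∈ flips t → u ∈ flips s → u ∈ flips t
flips-trans leaf (here refl) u∈ = u∈
flips-trans (node tl tr) s∈ u∈ with flip-node⁻ tl tr s∈
flips-trans (node tl tr) s∈ u∈ | unswapped {a} {c} a∈ c∈ refl with flip-node⁻ a c u∈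
... | unswapped a′∈ c′∈ refl = unswapped⁺ tl tr (flips-trans tl a∈ a′∈) (flips-trans tr c∈ c′∈)
... | swapped a′∈ c′∈ refl = swapped⁺ tl tr (flips-trans tl a∈ a′∈) (flips-trans tr c∈ c′∈)
flips-trans (node tl tr) s∈ u∈ | swapped {a} {c} a∈ c∈ refl with flip-node⁻ c a u∈
... | unswapped c′∈ a′∈ refl = swapped⁺ tl tr (flips-trans tl a∈ a′∈) (flips-trans tr c∈ c′∈)
... | swapped c′∈ a′∈ refl = unswapped⁺ tl tr (flips-trans tl a∈ a′∈) (flips-trans tr c∈ c′∈)

orbit⁺ : ∀ t {s} → s ∈ flips t → s ∈ orbit t
orbit⁺ t = ∈-deduplicate⁺ _≟T_

orbit⁻ : ∀ t {s} → s ∈ orbit t → s ∈ flips t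
orbit⁻ t = ∈-deduplicate⁻ _≟T_ (flips t)

orbit-unique : ∀ t → Unique (orbit t)
orbit-unique t = deduplicate-! (flips t)

orbit-nonempty : ∀ t → 0 < length (orbit t)
orbit-nonempty t with orbit t | orbit⁺ t (flips-refl t)
... | _ ∷ _ | _ = s≤s z≤n

orbit-≈ : ∀ {t s} → s ∈ flips t → orbit t ↭ orbit s
orbit-≈ {t} {s} s∈ = same-members⇒↭ (orbit-unique t) (orbit-unique s)
  (λ u∈ → orbit⁺ s (flips-trans s (flips-sym t s∈) (orbit⁻ t u∈)))
  (λ u∈ → orbit⁺ t (flips-trans t s∈ (orbit⁻ s u∈)))

node-injective : ∀ {a b c d} → node a c ≡ node b d → a ≡ b × c ≡ d
node-injective refl = refl , refl

-- If both root subtrees lie in one orbit, the root swap is absorbed: the orbit of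
-- node tl tr consists of the trees node a c with a, c in the orbit of l.
orbit-node-same : ∀ tl tr → tr ∈ flips tl → orbit (node tl tr) ↭ cartesianProductWith node (orbit tl) (orbit tl)
orbit-node-same tl tr tr∈ = same-members⇒↭ (orbit-unique (node tl tr))
  (Unique.cartesianProductWith⁺ node node-injective (orbit-unique tl) (orbit-unique tl)) to from
  where
  to : ∀ {z} → z ∈ orbit (node tl tr) → z ∈ cartesianProductWith node (orbit tl) (orbit tl)
  to z∈ with flip-node⁻ tl tr (orbit⁻ (node tl tr) z∈)
  ... | unswapped a∈ c∈ refl = ∈-cartesianProductWith⁺ node (orbit⁺ tl a∈) (orbit⁺ tl (flips-trans tl tr∈ c∈))
  ... | swapped a∈ c∈ refl = ∈-cartesianProductWith⁺ node (orbit⁺ tl (flips-trans tl tr∈ c∈)) (orbit⁺ tl a∈)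
  from : ∀ {z} → z ∈ cartesianProductWith node (orbit tl) (orbit tl) → z ∈ orbit (node tl tr)
  from z∈ with ∈-cartesianProductWith⁻ node (orbit tl) (orbit tl) z∈
  ... | _ , _ , a∈ , c∈ , refl =
    orbit⁺ (node tl tr) (unswapped⁺ tl tr (orbit⁻ tl a∈) (flips-trans tr (flips-sym tl tr∈) (orbit⁻ tl c∈)))

orbit-node-distinct : ∀ tl tr → tr ∉ flips tl →
  orbit (node tl tr) ↭ cartesianProductWith node (orbit tl) (orbit tr) ++ cartesianProductWith (λ a c → node c a) (orbit tl) (orbit tr)
orbit-node-distinct tl tr tr∉ = same-members⇒↭ (orbit-unique (node tl tr))
  (Unique.++⁺ (Unique.cartesianProductWith⁺ node node-injective (orbit-unique tl) (orbit-unique tr))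
              (Unique.cartesianProductWith⁺ (λ a c → node c a) (λ e → swap-pair (node-injective e)) (orbit-unique tl) (orbit-unique tr))
              disjoint)
  to from
  where
  swap-pair : ∀ {a b c d : Tree} → c ≡ d × a ≡ b → a ≡ b × c ≡ d
  swap-pair (p , q) = q , p
  unswappedList swappedList : List Tree
  unswappedList = cartesianProductWith node (orbit tl) (orbit tr)
  swappedList = cartesianProductWith (λ a c → node c a) (orbit tl) (orbit tr)
  disjoint : ∀ {v} → ¬ (v ∈ unswappedList × v ∈ swappedList)
  disjoint (v∈₁ , v∈₂) with ∈-cartesianProductWith⁻ node (orbit tl) (orbit tr) v∈₁
                          | ∈-cartesianProductWith⁻ (λ a c → node c a) (orbit tl) (orbit tr) v∈₂
  ... | _ , _ , a∈ , _ , refl | _ , _ , _ , c∈ , eq with node-injective eq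
  ...   | refl , refl = tr∉ (flips-trans tl (orbit⁻ tl a∈) (flips-sym tr (orbit⁻ tr c∈)))
  to : ∀ {z} → z ∈ orbit (node tl tr) → z ∈ unswappedList ++ swappedList
  to z∈ with flip-node⁻ tl tr (orbit⁻ (node tl tr) z∈)
  ... | unswapped a∈ c∈ refl = ∈-++⁺ˡ (∈-cartesianProductWith⁺ node (orbit⁺ tl a∈) (orbit⁺ tr c∈))
  ... | swapped a∈ c∈ refl = ∈-++⁺ʳ unswappedList (∈-cartesianProductWith⁺ (λ a c → node c a) (orbit⁺ tl a∈) (orbit⁺ tr c∈))
  from : ∀ {z} → z ∈ unswappedList ++ swappedList → z ∈ orbit (node tl tr)
  from z∈ with ∈-++⁻ unswappedList z∈
  ... | inj₁ p with ∈-cartesianProductWith⁻ node (orbit tl) (orbit tr) p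
  ...   | _ , _ , a∈ , c∈ , refl = orbit⁺ (node tl tr) (unswapped⁺ tl tr (orbit⁻ tl a∈) (orbit⁻ tr c∈))
  from z∈ | inj₂ p with ∈-cartesianProductWith⁻ (λ a c → node c a) (orbit tl) (orbit tr) p
  ...   | _ , _ , a∈ , c∈ , refl = orbit⁺ (node tl tr) (swapped⁺ tl tr (orbit⁻ tl a∈) (orbit⁻ tr c∈))

orbitSum : (ℕ → ℤ) → Tree → ℕ → ℤ
orbitSum b t x = listSum (λ s → w b s x) (orbit t)

orbitSize : Tree → ℕ
orbitSize t = length (orbit t)

-- Since w_b(node a c; x) = b(x)·w_b(a; x+1)·w_b(c; x), the orbit sums of a node are
-- products of orbit sums of its root subtrees.
orbitSum-split-same : ∀ b tl tr → tr ∈ flips tl → ∀ x →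
                      orbitSum b (node tl tr) x ≡ b x Z.* (orbitSum b tl (suc x) Z.* orbitSum b tl x)
orbitSum-split-same b tl tr tr∈ x = trans (listSum-↭ (λ s → w b s x) (orbit-node-same tl tr tr∈))
  (listSum-cartesian node (λ s → w b s x) (b x) (λ a → w b a (suc x)) (λ c → w b c x) (λ a c → refl) (orbit tl) (orbit tl))

orbitSum-split-distinct : ∀ b tl tr → tr ∉ flips tl → ∀ x →
                          orbitSum b (node tl tr) x ≡ b x Z.* (orbitSum b tl (suc x) Z.* orbitSum b tr x)
                                                      Z.+ b x Z.* (orbitSum b tl x Z.* orbitSum b tr (suc x))
orbitSum-split-distinct b tl tr tr∉ x = trans (listSum-↭ (λ s → w b s x) (orbit-node-distinct tl tr tr∉))
  (trans (listSum-++ (λ s → w b s x) (cartesianProductWith node (orbit tl) (orbit tr)) _)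
         (cong₂ Z._+_
           (listSum-cartesian node (λ s → w b s x) (b x) (λ a → w b a (suc x)) (λ c → w b c x) (λ a c → refl) (orbit tl) (orbit tr))
           (listSum-cartesian (λ a c → node c a) (λ s → w b s x) (b x) (λ a → w b a x) (λ c → w b c (suc x))
                              (λ a c → cong (b x Z.*_) (ZP.*-comm (w b c (suc x)) (w b a x))) (orbit tl) (orbit tr))))

orbitSize-split-same : ∀ tl tr → tr ∈ flips tl → orbitSize (node tl tr) ≡ orbitSize tl * orbitSize tl
orbitSize-split-same tl tr tr∈ = trans (Perm.↭-length (orbit-node-same tl tr tr∈)) (length-cartesian node (orbit tl) (orbit tl))

orbitSize-split-distinct : ∀ tl tr → tr ∉ flips tl → orbitSize (node tl tr) ≡ orbitSize tl * orbitSize tr + orbitSize tl * orbitSize tr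
orbitSize-split-distinct tl tr tr∉ = trans (Perm.↭-length (orbit-node-distinct tl tr tr∉))
  (trans (LP.length-++ (cartesianProductWith node (orbit tl) (orbit tr)))
         (cong₂ _+_ (length-cartesian node (orbit tl) (orbit tr)) (length-cartesian (λ a c → node c a) (orbit tl) (orbit tr))))

r-≈ : ∀ b t {s} → s ∈ flips t → r b s ≗ r b t
r-≈ b t {s} s∈ x = cong₂ _÷ℤ_ (sym (listSum-↭ (λ u → w b u x) (orbit-≈ {t} {s} s∈))) (sym (Perm.↭-length (orbit-≈ {t} {s} s∈)))

rootFactor : (ℕ → ℤ) → (ℕ → ℤ) → ℕ → ℤ
rootFactor f g = f · g ⊕ D f · g ⊕ f · D g

InF′-rootFactor : ∀ {f g} → InF′ f → InF′ g → InF′ (rootFactor f g)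
InF′-rootFactor f∈F g∈F =
  InF′-⊕ (InF′-⊕ (InF′-· f∈F g∈F) (InF′-· (InF′-D f∈F) g∈F)) (InF′-· f∈F (InF′-D g∈F))

module OrbitAverage (b : ℕ → ℤ) (b∈F : InF′ b) where

  record Averaged (t : Tree) : Set where
    field
      sum≡size*r : ∀ x → orbitSum b t x ≡ + orbitSize t Z.* r b t x
      r∈F : InF′ (r b t)

  open Averaged

  shifted-sum : ∀ {t} → Averaged t → ∀ x →
                orbitSum b t (suc x) ≡ + orbitSize t Z.* (r b t x Z.+ + 2 Z.* D (r b t) x)
  shifted-sum {t} av x = trans (sum≡size*r av (suc x)) (cong (+ orbitSize t Z.*_) (shift-by-D (r∈F av) x))

  -- Both root subtrees in one orbit (S_t = orbitSum b t, f = r_b(tl) = g): by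
  -- f(x+1) = f(x) + 2·Df(x), the sum b(x)·S_tl(x+1)·S_tl(x) equals
  -- |orbit|·b(x)·rootFactor f f (x).
  orbitSum-node-same : ∀ {tl tr} → Averaged tl → tr ∈ flips tl → ∀ x →
                       orbitSum b (node tl tr) x ≡ + orbitSize (node tl tr) Z.* (b · rootFactor (r b tl) (r b tr)) x
  orbitSum-node-same {tl} {tr} avl tr∈ x = begin
    orbitSum b (node tl tr) x
      ≡⟨ orbitSum-split-same b tl tr tr∈ x ⟩
    b x Z.* (orbitSum b tl (suc x) Z.* orbitSum b tl x)
      ≡⟨ cong₂ (λ u v → b x Z.* (u Z.* v)) (shifted-sum avl x) (sum≡size*r avl x) ⟩
    b x Z.* ((+ nl Z.* (f x Z.+ + 2 Z.* D f x)) Z.* (+ nl Z.* f x))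
      ≡⟨ same-identity (b x) (+ nl) (f x) (D f x) ⟩
    (+ nl Z.* + nl) Z.* (b · rootFactor f f) x
      ≡⟨ cong₂ Z._*_ (trans (sym (ZP.pos-* nl nl)) (cong +_ (sym (orbitSize-split-same tl tr tr∈))))
                     (cong (b x Z.*_) (cong₂ (λ u v → f x Z.* u Z.+ D f x Z.* u Z.+ f x Z.* v)
                                             (sym (r-≈ b tl tr∈ x)) (sym (digit-cong 1 (r-≈ b tl tr∈) x)))) ⟩
    + orbitSize (node tl tr) Z.* (b · rootFactor f g) x ∎
    where
    open ≡-Reasoning
    f g : ℕ → ℤ
    f = r b tl
    g = r b tr
    nl : ℕ
    nl = orbitSize tl
    same-identity : ∀ (B N F E : ℤ) → B Z.* ((N Z.* (F Z.+ + 2 Z.* E)) Z.* (N Z.* F))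
                                      ≡ (N Z.* N) Z.* (B Z.* (F Z.* F Z.+ E Z.* F Z.+ F Z.* E))
    same-identity = solve-∀

  orbitSum-node-distinct : ∀ {tl tr} → Averaged tl → Averaged tr → tr ∉ flips tl → ∀ x →
                           orbitSum b (node tl tr) x ≡ + orbitSize (node tl tr) Z.* (b · rootFactor (r b tl) (r b tr)) x
  orbitSum-node-distinct {tl} {tr} avl avr tr∉ x = begin
    orbitSum b (node tl tr) x
      ≡⟨ orbitSum-split-distinct b tl tr tr∉ x ⟩
    b x Z.* (orbitSum b tl (suc x) Z.* orbitSum b tr x) Z.+ b x Z.* (orbitSum b tl x Z.* orbitSum b tr (suc x))
      ≡⟨ cong₂ Z._+_ (cong₂ (λ u v → b x Z.* (u Z.* v)) (shifted-sum avl x) (sum≡size*r avr x))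
                     (cong₂ (λ u v → b x Z.* (u Z.* v)) (sum≡size*r avl x) (shifted-sum avr x)) ⟩
    b x Z.* ((+ nl Z.* (f x Z.+ + 2 Z.* D f x)) Z.* (+ nr Z.* g x))
      Z.+ b x Z.* ((+ nl Z.* f x) Z.* (+ nr Z.* (g x Z.+ + 2 Z.* D g x)))
      ≡⟨ distinct-identity (b x) (+ nl) (+ nr) (f x) (D f x) (g x) (D g x) ⟩
    (+ nl Z.* + nr Z.+ + nl Z.* + nr) Z.* (b · rootFactor f g) x
      ≡⟨ cong (Z._* (b · rootFactor f g) x)
              (trans (cong₂ Z._+_ (sym (ZP.pos-* nl nr)) (sym (ZP.pos-* nl nr)))
                     (trans (sym (ZP.pos-+ (nl * nr) (nl * nr))) (cong +_ (sym (orbitSize-split-distinct tl tr tr∉))))) ⟩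
    + orbitSize (node tl tr) Z.* (b · rootFactor f g) x ∎
    where
    open ≡-Reasoning
    f g : ℕ → ℤ
    f = r b tl
    g = r b tr
    nl : ℕ
    nl = orbitSize tl
    nr : ℕ
    nr = orbitSize tr
    distinct-identity : ∀ (B M N F E G H : ℤ) →
      B Z.* ((M Z.* (F Z.+ + 2 Z.* E)) Z.* (N Z.* G)) Z.+ B Z.* ((M Z.* F) Z.* (N Z.* (G Z.+ + 2 Z.* H)))
      ≡ (M Z.* N Z.+ M Z.* N) Z.* (B Z.* (F Z.* G Z.+ E Z.* G Z.+ F Z.* H))
    distinct-identity = solve-∀

  orbitSum-node : ∀ {tl tr} → Averaged tl → Averaged tr → ∀ x →
                  orbitSum b (node tl tr) x ≡ + orbitSize (node tl tr) Z.* (b · rootFactor (r b tl) (r b tr)) x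
  orbitSum-node {tl} {tr} avl avr with tr ∈? flips tl
  ... | yes tr∈ = orbitSum-node-same avl tr∈
  ... | no tr∉ = orbitSum-node-distinct avl avr tr∉

  r-node : ∀ {tl tr} → Averaged tl → Averaged tr → r b (node tl tr) ≗ b · rootFactor (r b tl) (r b tr)
  r-node {tl} {tr} avl avr x =
    trans (cong (_÷ℤ orbitSize (node tl tr)) (orbitSum-node avl avr x)) (divide-exact (orbit-nonempty (node tl tr)) _)

  averaged : ∀ t → Averaged t
  averaged leaf = record
    { sum≡size*r = λ x → refl
    ; r∈F = InF′-cong (λ x → refl) (InF′-const (+ 1))
    }
  averaged (node tl tr) = record
    { sum≡size*r = λ x → trans (orbitSum-node avl avr x) (cong (+ orbitSize (node tl tr) Z.*_) (sym (r-node avl avr x)))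
    ; r∈F = InF′-cong (λ x → sym (r-node avl avr x)) (InF′-· b∈F (InF′-rootFactor (r∈F avl) (r∈F avr)))
    }
    where
    avl : Averaged tl
    avl = averaged tl
    avr : Averaged tr
    avr = averaged tr

+-rootPolynomial : ∀ a a′ c c′ → + a Z.* + c Z.+ + a′ Z.* + c Z.+ + a Z.* + c′ ≡ + (a * c + a′ * c + a * c′)
+-rootPolynomial a a′ c c′ = sym (trans (ZP.pos-+ (a * c + a′ * c) (a * c′))
  (cong₂ Z._+_ (trans (ZP.pos-+ (a * c) (a′ * c)) (cong₂ Z._+_ (ZP.pos-* a c) (ZP.pos-* a′ c))) (ZP.pos-* a c′)))

rootFactor-digit : ∀ n {f g} → InF′ f → InF′ g →
  digit n (rootFactor f g) 0 ≈₂ pascalSum n (λ i j → + (ε i f * ε j g + ε (suc i) f * ε j g + ε i f * ε (suc j) g))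
rootFactor-digit n {f} {g} f∈F g∈F = begin
  digit n (f · g ⊕ D f · g ⊕ f · D g) 0
    ≡⟨ trans (digit-⊕ (InF′-⊕ fg∈F Dfg∈F) fDg∈F n 0) (cong (Z._+ digit n (f · D g) 0) (digit-⊕ fg∈F Dfg∈F n 0)) ⟩
  digit n (f · g) 0 Z.+ digit n (D f · g) 0 Z.+ digit n (f · D g) 0
    ≈⟨ ≈₂-+ (≈₂-+ (leibniz-mod2 n f∈F g∈F 0) (leibniz-mod2 n Df∈F g∈F 0)) (leibniz-mod2 n f∈F Dg∈F 0) ⟩
  pascalSum n (λ i j → d i f Z.* d j g) Z.+ pascalSum n (λ i j → d i (D f) Z.* d j g)
    Z.+ pascalSum n (λ i j → d i f Z.* d j (D g))
    ≡⟨ trans (cong (Z._+ pascalSum n (λ i j → d i f Z.* d j (D g))) (pascalSum-+ n _ _)) (pascalSum-+ n _ _) ⟩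
  pascalSum n (λ i j → d i f Z.* d j g Z.+ d i (D f) Z.* d j g Z.+ d i f Z.* d j (D g))
    ≈⟨ pascalSum-≈₂ n (λ i j → ≈₂-trans (≈₂-+ (≈₂-+ (≈₂-* (parity f i) (parity g j)) (≈₂-* (parity-D f∈F i) (parity g j)))
                                                (≈₂-* (parity f i) (parity-D g∈F j)))
                                         (≈₂-reflexive (+-rootPolynomial (ε i f) (ε (suc i) f) (ε j g) (ε (suc j) g)))) ⟩
  pascalSum n (λ i j → + (ε i f * ε j g + ε (suc i) f * ε j g + ε i f * ε (suc j) g)) ∎
  where
  open ≈₂-Reasoning
  d : ℕ → (ℕ → ℤ) → ℤ
  d i h = digit i h 0
  Df∈F : InF′ (D f)
  Df∈F = InF′-D f∈F
  Dg∈F : InF′ (D g)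
  Dg∈F = InF′-D g∈F
  fg∈F : InF′ (f · g)
  fg∈F = InF′-· f∈F g∈F
  Dfg∈F : InF′ (D f · g)
  Dfg∈F = InF′-· Df∈F g∈F
  fDg∈F : InF′ (f · D g)
  fDg∈F = InF′-· f∈F Dg∈F
  parity : ∀ h i → d i h ≈₂ + ε i h
  parity h i = ≈₂-remainder (d i h)
  parity-D : ∀ {h} → InF′ h → ∀ i → d i (D h) ≈₂ + ε (suc i) h
  parity-D h∈F i = ≈₂-trans (≈₂-reflexive (digit-D h∈F i 0)) (≈₂-remainder _)

lemma2p10 : (b : ℕ → ℤ) → InF b → (tl tr : Tree) → (m : ℕ) →
    εO b m (node tl tr) % 2 ≡
      Σtriple m (λ i j k → multinomial m i j k * ε k b *
        (εO b i tl * εO b j tr + εO b (suc i) tl * εO b j tr + εO b i tl * εO b (suc j) tr)) % 2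
lemma2p10 b b∈F tl tr m = ≈₂⇒%2≡ (begin
  + εO b m (node tl tr)
    ≈⟨ ≈₂-sym (≈₂-remainder _) ⟩
  digit m (r b (node tl tr)) 0
    ≡⟨ digit-cong m (λ x → trans (r-node avl avr x) (ZP.*-comm (b x) _)) 0 ⟩
  digit m (rootFactor f g · b) 0
    ≈⟨ leibniz-mod2 m (InF′-rootFactor (r∈F avl) (r∈F avr)) b∈F′ 0 ⟩
  pascalSum m (λ n k → digit n (rootFactor f g) 0 Z.* digit k b 0)
    ≈⟨ pascalSum-≈₂ m (λ n k → ≈₂-* (rootFactor-digit n (r∈F avl) (r∈F avr)) (≈₂-remainder _)) ⟩
  pascalSum m (λ n k → pascalSum n (λ i j → + Y i j) Z.* + ε k b)
    ≡⟨ pascalSum-cong m (λ n k → trans (pascalSum-scaleʳ n _ _) (pascalSum-cong n (λ i j → sym (ZP.pos-* (Y i j) (ε k b))))) ⟩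
  pascalSum m (λ n k → pascalSum n (λ i j → + (Y i j * ε k b)))
    ≡⟨ pascalSum-nested m (λ i j k → Y i j * ε k b) ⟩
  + Σtriple m (λ i j k → multinomial m i j k * (Y i j * ε k b))
    ≡⟨ cong +_ (Σtriple-cong m (λ i j k → reorder (multinomial m i j k) (Y i j) (ε k b))) ⟩
  + Σtriple m (λ i j k → multinomial m i j k * ε k b * Y i j) ∎)
  where
  open ≈₂-Reasoning
  open OrbitAverage b (InF⇒InF′ b∈F)
  open Averaged
  b∈F′ : InF′ b
  b∈F′ = InF⇒InF′ b∈F
  avl : Averaged tl
  avl = averaged tl
  avr : Averaged tr
  avr = averaged tr
  f g : ℕ → ℤ
  f = r b tl
  g = r b tr
  Y : ℕ → ℕ → ℕ
  Y i j = εO b i tl * εO b j tr + εO b (suc i) tl * εO b j tr + εO b i tl * εO b (suc j) tr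
  reorder : ∀ c y e → c * (y * e) ≡ c * e * y
  reorder c y e = trans (cong (c *_) (NP.*-comm y e)) (sym (NP.*-assoc c e y))
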